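{- Let $G$ be the $2$-subdivision of a cubic graph, let $k\in\mathbb{N}$, and let $G^*$ be obtained from $G$ by adding, for each edge $uv\in E(G)$, a new vertex $w$ together with the edges $wu$ and $wv$. Then $G$ has a vertex cover of size at most $k$ if and only if $G^*$ can be transformed into a bipartite graph by at most $k$ successive vertex splits.
   Context: Graphs are finite, simple, undirected. The $2$-subdivision of a graph replaces each edge $uv$ by a path $u,p_1,p_2,v$ with two new internal vertices. A vertex split of a vertex $v$ of a graph $H$: choose $V_1,V_2\subseteq N_H(v)$ with $V_1\cup V_2=N_H(v)$, delete $v$, add new vertices $v_1,v_2$ with $N(v_1)=V_1$, $N(v_2)=V_2$. -}

module Defs where

open import Data.Nat using (ℕ; zero; suc; _≤_; _<_)
open import Data.Fin using (Fin; toℕ)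
open import Data.Bool using (Bool; true; false; if_then_else_)
open import Data.List using (List; length; map; allFin)
open import Data.Nat.ListAction using (sum)
open import Data.List.Membership.Propositional using (_∈_)
open import Data.Product using (Σ; _×_; _,_; proj₁; proj₂; ∃)
open import Data.Sum using (_⊎_; inj₁; inj₂)
open import Data.Unit using (⊤; tt)
open import Data.Empty using (⊥)
open import Relation.Nullary using (¬_)
open import Relation.Binary.PropositionalEquality using (_≡_; _≢_; refl; sym)

record SimpleGraph (n : ℕ) : Set where
  field
    adj    : Fin n → Fin n → Bool
    symm   : ∀ u v → adj u v ≡ adj v u
    irrefl : ∀ u → adj u u ≡ false
open SimpleGraph public

degree : ∀ {n} → SimpleGraph n → Fin n → ℕ
degree {n} H v = sum (map (λ u → if adj H v u then 1 else 0) (allFin n))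

Cubic : ∀ {n} → SimpleGraph n → Set
Cubic H = ∀ v → degree H v ≡ 3

EdgeOf : ∀ {n} → SimpleGraph n → Set
EdgeOf {n} H = Σ (Fin n) λ u → Σ (Fin n) λ v → (toℕ u < toℕ v) × (adj H u v ≡ true)

record Graph (V : Set) : Set₁ where
  field
    E      : V → V → Set
    E-sym  : ∀ {x y} → E x y → E y x
    E-irr  : ∀ {x} → E x x → ⊥
open Graph public

symGraph : ∀ {V : Set} (D : V → V → Set) → (∀ x → D x x → ⊥) → Graph V
symGraph D noloop = record
  { E = λ x y → D x y ⊎ D y x
  ; E-sym = λ { (inj₁ p) → inj₂ p ; (inj₂ p) → inj₁ p }
  ; E-irr = λ { {x} (inj₁ p) → noloop x p ; {x} (inj₂ p) → noloop x p } }

-- 2-subdivision of H: edge e = uv (u<v) becomes path u, (e,true), (e,false), v.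

SubV : ∀ {n} → SimpleGraph n → Set
SubV {n} H = Fin n ⊎ (EdgeOf H × Bool)

subD : ∀ {n} (H : SimpleGraph n) → SubV H → SubV H → Set
subD H (inj₁ x) (inj₂ (e , true)) = x ≡ proj₁ e
subD H (inj₂ (e , true)) (inj₂ (e' , false)) = e ≡ e'
subD H (inj₂ (e , false)) (inj₁ y) = y ≡ proj₁ (proj₂ e)
subD H _ _ = ⊥

subD-noloop : ∀ {n} (H : SimpleGraph n) x → subD H x x → ⊥
subD-noloop H (inj₁ x) ()
subD-noloop H (inj₂ (e , true)) ()
subD-noloop H (inj₂ (e , false)) ()

subdivision2 : ∀ {n} (H : SimpleGraph n) → Graph (SubV H)
subdivision2 H = symGraph (subD H) (subD-noloop H)

SubEdge : ∀ {n} → SimpleGraph n → Set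
SubEdge H = EdgeOf H × Fin 3

subEnds : ∀ {n} (H : SimpleGraph n) → SubEdge H → SubV H × SubV H
subEnds H (e , Fin.zero) = inj₁ (proj₁ e) , inj₂ (e , true)
  where import Data.Fin as Fin
subEnds H (e , Fin.suc Fin.zero) = inj₂ (e , true) , inj₂ (e , false)
  where import Data.Fin as Fin
subEnds H (e , Fin.suc (Fin.suc Fin.zero)) = inj₂ (e , false) , inj₁ (proj₁ (proj₂ e))
  where import Data.Fin as Fin

starD : ∀ {V Ed : Set} (G : Graph V) (ends : Ed → V × V) → V ⊎ Ed → V ⊎ Ed → Set
starD G ends (inj₁ x) (inj₁ y) = E G x y
starD G ends (inj₂ f) (inj₁ x) = (x ≡ proj₁ (ends f)) ⊎ (x ≡ proj₂ (ends f))
starD G ends _ _ = ⊥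

starD-noloop : ∀ {V Ed : Set} (G : Graph V) (ends : Ed → V × V) x → starD G ends x x → ⊥
starD-noloop G ends (inj₁ x) p = E-irr G p
starD-noloop G ends (inj₂ f) ()

addEdgeVertices : ∀ {V Ed : Set} (G : Graph V) (ends : Ed → V × V) → Graph (V ⊎ Ed)
addEdgeVertices G ends = symGraph (starD G ends) (starD-noloop G ends)

star : ∀ {n} (H : SimpleGraph n) → Graph (SubV H ⊎ SubEdge H)
star H = addEdgeVertices (subdivision2 H) (subEnds H)

HasVertexCoverOfSize≤ : ∀ {V : Set} → Graph V → ℕ → Set
HasVertexCoverOfSize≤ {V} G k =
  ∃ λ (C : List V) → (length C ≤ k) × (∀ x y → E G x y → (x ∈ C) ⊎ (y ∈ C))

Bipartite : ∀ {V : Set} → Graph V → Set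
Bipartite {V} G = ∃ λ (c : V → Bool) → ∀ x y → E G x y → c x ≢ c y

-- The result has vertex type V ⊎ ⊤: vertex inj₁ v plays the role of v₁
-- (neighbourhood V1) and inj₂ tt is v₂ (neighbourhood V2); v itself is gone.

record SplitData {V : Set} (G : Graph V) : Set₁ where
  field
    v   : V
    V₁  : V → Set
    V₂  : V → Set
    V₁⊆ : ∀ {x} → V₁ x → E G v x
    V₂⊆ : ∀ {x} → V₂ x → E G v x
    N⊆  : ∀ {x} → E G v x → V₁ x ⊎ V₂ x
open SplitData public

splitD : ∀ {V : Set} (G : Graph V) (s : SplitData G) → V ⊎ ⊤ → V ⊎ ⊤ → Set
splitD G s (inj₁ x) (inj₁ y) = (x ≢ v s × y ≢ v s × E G x y) ⊎ (x ≡ v s × V₁ s y)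
splitD G s (inj₂ _) (inj₁ y) = V₂ s y
splitD G s _ _ = ⊥

splitD-noloop : ∀ {V : Set} (G : Graph V) (s : SplitData G) x → splitD G s x x → ⊥
splitD-noloop G s (inj₁ x) (inj₁ (_ , _ , p)) = E-irr G p
splitD-noloop G s (inj₁ x) (inj₂ (refl , q)) = E-irr G (V₁⊆ s q)
splitD-noloop G s (inj₂ _) ()

split : ∀ {V : Set} (G : Graph V) → SplitData G → Graph (V ⊎ ⊤)
split G s = symGraph (splitD G s) (splitD-noloop G s)

data BipartiteAfterSplits : {V : Set} → Graph V → ℕ → Set₁ where
  done : ∀ {V : Set} {G : Graph V} {k} → Bipartite G → BipartiteAfterSplits G k
  step : ∀ {V : Set} {G : Graph V} {k} (s : SplitData G) →
         BipartiteAfterSplits (split G s) k → BipartiteAfterSplits G (suc k)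

{-# OPTIONS --safe #-}
module Submission where

-- Colour the vertices of G and the added edge-vertices of G* differently.  Only edges of
-- G are monochromatic, so for a vertex cover C of G split each w ∈ C into w, keeping its
-- edge-vertex neighbours, and a fresh vertex of the edge-vertex colour carrying its
-- G-neighbours: the colouring becomes proper.
-- Conversely, a split destroys only triangles through the split vertex and a
-- bipartite graph has none, so k splits making G* bipartite yield k vertices meeting
-- every triangle; each edge uv of G lies in the triangle u v w_uv, where w_uv may be
-- traded for u.

open import Defs
open import Data.Nat using (ℕ; _≤_; z≤n; s≤s)
open import Data.Nat.Properties using (<-irrelevant)
open import Data.Fin using (zero; suc)
import Data.Fin.Properties as Fin
open import Data.Bool using (Bool; true; false; not)
open import Data.Bool.Properties using (¬-not; not-¬; not-involutive)
import Data.Bool.Properties as Bool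
open import Data.List using (List; []; _∷_; length; map)
open import Data.List.Properties using (length-map)
open import Data.List.Membership.Propositional using (_∈_)
open import Data.List.Membership.Propositional.Properties using (∈-map⁺)
open import Data.List.Relation.Unary.Any using (here; there)
open import Data.Product using (_×_; _,_; proj₁; proj₂; ∃; map₂)
import Data.Product.Properties as Product
open import Data.Sum using (_⊎_; inj₁; inj₂; [_,_]′; swap)
import Data.Sum as Sum
import Data.Sum.Properties as Sum
open import Data.Unit using (⊤)
import Data.Unit.Properties as Unit
open import Data.Empty using (⊥-elim)
open import Function using (_∘_; id; const)
open import Function.Bundles using (_⇔_; mk⇔)
open import Relation.Nullary using (Irrelevant; yes; no)
open import Relation.Nullary.Decidable using (toSum)
open import Relation.Binary.Definitions using (DecidableEquality)
open import Relation.Binary.PropositionalEquality using (_≡_; _≢_; refl; sym; trans; cong; subst)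
open import Axiom.UniquenessOfIdentityProofs using (module Decidable⇒UIP)

symClosure-ind : ∀ {V : Set} {D : V → V → Set} (P : V → V → Set) →
                 (∀ {x y} → P x y → P y x) → (∀ {x y} → D x y → P x y) →
                 ∀ {x y} → D x y ⊎ D y x → P x y
symClosure-ind P P-sym P-D (inj₁ d) = P-D d
symClosure-ind P P-sym P-D (inj₂ d) = P-sym (P-D d)

module _ {V : Set} (c : V → Bool) (C : List V) where

  CoveredIfMonochromatic : V → V → Set
  CoveredIfMonochromatic x y = c x ≡ c y → x ∈ C ⊎ y ∈ C

  coveredIfMonochromatic-sym : ∀ {x y} → CoveredIfMonochromatic x y → CoveredIfMonochromatic y x
  coveredIfMonochromatic-sym h = swap ∘ h ∘ sym

MonochromaticEdgesCoveredBy : ∀ {V : Set} → Graph V → (V → Bool) → List V → Set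
MonochromaticEdgesCoveredBy G c C = ∀ {x y} → E G x y → CoveredIfMonochromatic c C x y

splitByColour : ∀ {V : Set} (G : Graph V) (c : V → Bool) (w : V) → SplitData G
splitByColour G c w = record
  { v   = w
  ; V₁  = λ y → E G w y × c y ≢ c w
  ; V₂  = λ y → E G w y × c y ≡ c w
  ; V₁⊆ = proj₁
  ; V₂⊆ = proj₁
  ; N⊆  = λ {y} e → Sum.map (e ,_) (e ,_) (swap (toSum (c y Bool.≟ c w)))
  }

recolourSplit : ∀ {V : Set} (c : V → Bool) (w : V) → V ⊎ ⊤ → Bool
recolourSplit c w = [ c , const (not (c w)) ]′

splitByColour-monochromaticEdgesCovered :
  ∀ {V : Set} (G : Graph V) (c : V → Bool) (w : V) (C : List V) →
  MonochromaticEdgesCoveredBy G c (w ∷ C) →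
  MonochromaticEdgesCoveredBy (split G (splitByColour G c w)) (recolourSplit c w) (map inj₁ C)
splitByColour-monochromaticEdgesCovered G c w C cov =
  symClosure-ind (CoveredIfMonochromatic c′ C′) (coveredIfMonochromatic-sym c′ C′) covered
  where
  c′ = recolourSplit c w
  C′ = map inj₁ C

  keep : ∀ {x} → x ≢ w → x ∈ w ∷ C → inj₁ x ∈ C′
  keep x≢w (here x≡w) = ⊥-elim (x≢w x≡w)
  keep x≢w (there x∈C) = ∈-map⁺ inj₁ x∈C

  covered : ∀ {x y} → splitD G (splitByColour G c w) x y → CoveredIfMonochromatic c′ C′ x y
  covered {inj₁ _} {inj₁ _} (inj₁ (x≢w , y≢w , e)) same = Sum.map (keep x≢w) (keep y≢w) (cov e same)
  covered {inj₁ _} {inj₁ _} (inj₂ (refl , _ , cy≢cw)) same = ⊥-elim (cy≢cw (sym same))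
  covered {inj₂ _} {inj₁ _} (_ , cy≡cw)               same = ⊥-elim (not-¬ cy≡cw (sym same))

splitsFromMonochromaticCover :
  ∀ {V : Set} (G : Graph V) (c : V → Bool) (C : List V) {k : ℕ} →
  length C ≤ k → MonochromaticEdgesCoveredBy G c C → BipartiteAfterSplits G k
splitsFromMonochromaticCover G c [] _ cov =
  done (c , λ _ _ e same → [ (λ ()) , (λ ()) ]′ (cov e same))
splitsFromMonochromaticCover G c (w ∷ C) (s≤s |C|≤k) cov =
  step (splitByColour G c w)
    (splitsFromMonochromaticCover _ (recolourSplit c w) (map inj₁ C)
      (subst (_≤ _) (sym (length-map inj₁ C)) |C|≤k)
      (splitByColour-monochromaticEdgesCovered G c w C cov))

HitsTriangles : ∀ {V : Set} → Graph V → List V → Set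
HitsTriangles G S = ∀ {x y z} → E G x y → E G y z → E G x z → x ∈ S ⊎ y ∈ S ⊎ z ∈ S

bipartite⇒hitsTriangles[] : ∀ {V : Set} {G : Graph V} → Bipartite G → HitsTriangles G []
bipartite⇒hitsTriangles[] {G = G} (c , proper) {x} {y} {z} exy eyz exz =
  ⊥-elim (proper x z exz cx≡cz)
  where
  cx≡cz : c x ≡ c z
  cx≡cz = trans (¬-not (proper x y exy))
         (trans (cong not (¬-not (proper y z eyz))) (not-involutive (c z)))

unsplit : ∀ {V : Set} {G : Graph V} → SplitData G → V ⊎ ⊤ → V
unsplit s = [ id , const (v s) ]′

split-hitsTriangles : ∀ {V : Set} {G : Graph V} → DecidableEquality V → (s : SplitData G) →
                      ∀ {S} → HitsTriangles (split G s) S → HitsTriangles G (v s ∷ map (unsplit s) S)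
split-hitsTriangles {G = G} _≟_ s {S} hits {x} {y} {z} exy eyz exz
  with x ≟ v s | y ≟ v s | z ≟ v s
... | yes x≡v | _       | _       = inj₁ (here x≡v)
... | no _    | yes y≡v | _       = inj₂ (inj₁ (here y≡v))
... | no _    | no _    | yes z≡v = inj₂ (inj₂ (here z≡v))
... | no x≢v  | no y≢v  | no z≢v  =
  Sum.map lift (Sum.map lift lift) (hits (kept x≢v y≢v exy) (kept y≢v z≢v eyz) (kept x≢v z≢v exz))
  where
  kept : ∀ {a b} → a ≢ v s → b ≢ v s → E G a b → E (split G s) (inj₁ a) (inj₁ b)
  kept a≢v b≢v e = inj₁ (inj₁ (a≢v , b≢v , e))

  lift : ∀ {a} → inj₁ a ∈ S → a ∈ v s ∷ map (unsplit s) S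
  lift = there ∘ ∈-map⁺ (unsplit s)

triangleHittingSet : ∀ {V : Set} {G : Graph V} {k : ℕ} → DecidableEquality V →
                     BipartiteAfterSplits G k → ∃ λ S → length S ≤ k × HitsTriangles G S
triangleHittingSet {G = G} _≟_ (done bip) = [] , z≤n , bipartite⇒hitsTriangles[] {G = G} bip
triangleHittingSet _≟_ (step s B) =
  let S , |S|≤k , hits = triangleHittingSet (Sum.≡-dec _≟_ Unit._≟_) B
  in v s ∷ map (unsplit s) S
   , s≤s (subst (_≤ _) (sym (length-map (unsplit s) S)) |S|≤k)
   , split-hitsTriangles _≟_ s hits

module _ {V Ed : Set} (G : Graph V) (ends : Ed → V × V) where

  private
    G⁺ : Graph (V ⊎ Ed)
    G⁺ = addEdgeVertices G ends

  vertexCover⇒splits : ∀ {k} → HasVertexCoverOfSize≤ G k → BipartiteAfterSplits G⁺ k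
  vertexCover⇒splits (C , |C|≤k , cover) =
    splitsFromMonochromaticCover G⁺ isOld (map inj₁ C)
      (subst (_≤ _) (sym (length-map inj₁ C)) |C|≤k)
      (symClosure-ind (CoveredIfMonochromatic isOld (map inj₁ C))
                      (coveredIfMonochromatic-sym isOld (map inj₁ C)) covered)
    where
    isOld : V ⊎ Ed → Bool
    isOld = [ const true , const false ]′

    covered : ∀ {x y} → starD G ends x y → CoveredIfMonochromatic isOld (map inj₁ C) x y
    covered {inj₁ x} {inj₁ y} e _ = Sum.map (∈-map⁺ inj₁) (∈-map⁺ inj₁) (cover x y e)
    covered {inj₂ _} {inj₁ _} _ ()

  Listed : V → V → Set
  Listed x y = ∃ λ f → ends f ≡ (x , y) ⊎ ends f ≡ (y , x)

  EdgesListed : Set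
  EdgesListed = ∀ {x y} → E G x y → Listed x y

  firstEnd : V ⊎ Ed → V
  firstEnd = [ id , proj₁ ∘ ends ]′

  hitsTriangles⇒vertexCover : EdgesListed → ∀ {S} → HitsTriangles G⁺ S →
                              ∀ x y → E G x y → x ∈ map firstEnd S ⊎ y ∈ map firstEnd S
  hitsTriangles⇒vertexCover listed {S} hits x y e =
    [ coverVia e , swap ∘ coverVia (E-sym G e) ]′ (proj₂ (listed e))
    where
    coverVia : ∀ {a b f} → E G a b → ends f ≡ (a , b) → a ∈ map firstEnd S ⊎ b ∈ map firstEnd S
    coverVia {a} {b} {f} eab ends≡ =
      [ inj₁ ∘ ∈-map⁺ firstEnd
      , [ inj₂ ∘ ∈-map⁺ firstEnd
        , inj₁ ∘ subst (_∈ map firstEnd S) a≡ ∘ ∈-map⁺ firstEnd ]′ ]′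
      (hits {inj₁ a} {inj₁ b} {inj₂ f} (inj₁ eab) (inj₂ (inj₂ (sym b≡))) (inj₂ (inj₁ (sym a≡))))
      where
      a≡ : proj₁ (ends f) ≡ a
      a≡ = cong proj₁ ends≡
      b≡ : proj₂ (ends f) ≡ b
      b≡ = cong proj₂ ends≡

  splits⇒vertexCover : DecidableEquality (V ⊎ Ed) → EdgesListed →
                       ∀ {k} → BipartiteAfterSplits G⁺ k → HasVertexCoverOfSize≤ G k
  splits⇒vertexCover _≟_ listed B =
    let S , |S|≤k , hits = triangleHittingSet _≟_ B
    in map firstEnd S
     , subst (_≤ _) (sym (length-map firstEnd S)) |S|≤k
     , hitsTriangles⇒vertexCover listed hits

module _ {n : ℕ} (H : SimpleGraph n) where

  subEnds-listsEdges : EdgesListed (subdivision2 H) (subEnds H)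
  subEnds-listsEdges =
    symClosure-ind (Listed (subdivision2 H) (subEnds H)) (map₂ swap) (map₂ inj₁ ∘ listed)
    where
    listed : ∀ {x y} → subD H x y → ∃ λ f → subEnds H f ≡ (x , y)
    listed {inj₁ _}              {inj₂ (e , true)}  refl = (e , zero) , refl
    listed {inj₂ (e , true)}     {inj₂ (_ , false)} refl = (e , suc zero) , refl
    listed {inj₂ (e , false)}    {inj₁ _}           refl = (e , suc (suc zero)) , refl

  starVertex-≟ : DecidableEquality (SubV H ⊎ SubEdge H)
  starVertex-≟ = Sum.≡-dec (Sum.≡-dec Fin._≟_ (Product.≡-dec edge-≟ Bool._≟_))
                           (Product.≡-dec edge-≟ Fin._≟_)
    where
    irrelevant⇒≟ : ∀ {A : Set} → Irrelevant A → DecidableEquality A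
    irrelevant⇒≟ irr a b = yes (irr a b)

    edge-≟ : DecidableEquality (EdgeOf H)
    edge-≟ = Product.≡-dec Fin._≟_ (Product.≡-dec Fin._≟_
               (Product.≡-dec (irrelevant⇒≟ <-irrelevant)
                              (irrelevant⇒≟ (Decidable⇒UIP.≡-irrelevant Bool._≟_))))

mainTheorem19 : (n : ℕ) (H : SimpleGraph n) → Cubic H → (k : ℕ) →
    HasVertexCoverOfSize≤ (subdivision2 H) k ⇔ BipartiteAfterSplits (star H) k
mainTheorem19 n H _ k =
  mk⇔ (vertexCover⇒splits G (subEnds H))
      (splits⇒vertexCover G (subEnds H) (starVertex-≟ H) (subEnds-listsEdges H))
  where
  G = subdivision2 H
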